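{- Let $p\in\mathrm{OFS}(\mathbb{Z}^+)$ with $n=|p|>1$, $\gcd(p|_{n-1})=\gcd(p)$, and $\max(p)<fw(p|_{n-1})$. Then $fw(p|_{n-1})\ge fw(p)$.
   Context: $\mathrm{OFS}(\mathbb{Z}^+)$ denotes the set of all nonempty strictly increasing finite sequences of positive integers. For $p\in\mathrm{OFS}(\mathbb{Z}^+)$, $|p|$ is its length, $p_i$ its $i$-th entry, $p|_i=(p_1,\ldots,p_i)$, $\gcd(p)$ the gcd of its entries, $\max(p)=p_{|p|}$. The map $R$: $R(p)=p$ if $|p|=1$; if $n=|p|>1$, form $(p_2-p_1,\ldots,p_n-p_1)$ and, if $p_1$ does not appear in it, insert $p_1$ so that the result is strictly increasing. $f$ is defined recursively by $f(p)=p_1$ if $|p|=1$ and $f(p)=p_1+f(R(p))$ if $|p|>1$. $fw$ is defined by: if $n=|p|>1$, $\gcd(p|_{n-1})=\gcd(p)$ and $\max(p)\ge f(p|_{n-1})$, then $fw(p)=fw(p|_{n-1})$; otherwise $fw(p)=f(p)$. -}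

module Defs where

open import Data.Nat using (ℕ; zero; suc; _+_; _∸_; _<_; _≤_; _≤?_; _≟_)
open import Data.Nat.GCD using (gcd)
open import Data.List using (List; []; _∷_; map; foldr; length; take)
open import Data.List.Relation.Unary.All using (All)
open import Data.List.Relation.Unary.Linked using (Linked)
open import Data.Product using (_×_)
open import Relation.Binary.PropositionalEquality using (_≢_)
open import Relation.Nullary using (yes; no)

-- Finite sequences are lists of naturals.
-- OFS(ℤ⁺): nonempty, strictly increasing, all entries positive.
IsOFS : List ℕ → Set
IsOFS p = (p ≢ []) × (All (λ x → 0 < x) p × Linked _<_ p)

maxL : List ℕ → ℕ
maxL []           = 0
maxL (x ∷ [])     = x
maxL (x ∷ y ∷ ys) = maxL (y ∷ ys)

gcdL : List ℕ → ℕ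
gcdL = foldr gcd 0

initL : List ℕ → List ℕ
initL p = take (length p ∸ 1) p

insertNew : ℕ → List ℕ → List ℕ
insertNew x [] = x ∷ []
insertNew x (y ∷ ys) with suc x ≤? y | x ≟ y
... | yes _ | _     = x ∷ y ∷ ys
... | no _  | yes _ = y ∷ ys
... | no _  | no _  = y ∷ insertNew x ys

R : List ℕ → List ℕ
R []           = []
R (x ∷ [])     = x ∷ []
R (x ∷ y ∷ ys) = insertNew x (map (_∸ x) (y ∷ ys))

-- f with a fuel argument; for p ∈ OFS(ℤ⁺), maxL strictly decreases under R
-- (when |p| > 1), so fuel = maxL p suffices and f below agrees with the
-- paper's recursive definition on OFS(ℤ⁺).
fFuel : ℕ → List ℕ → ℕ
fFuel _       []           = 0
fFuel _       (x ∷ [])     = x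
fFuel zero    (x ∷ y ∷ ys) = 0
fFuel (suc k) (x ∷ y ∷ ys) = x + fFuel k (R (x ∷ y ∷ ys))

f : List ℕ → ℕ
f p = fFuel (maxL p) p

-- fw with fuel = length p (the recursion shortens p by one each step)
fwFuel : ℕ → List ℕ → ℕ
fwFuel zero p = f p
fwFuel (suc k) p with 2 ≤? length p | gcdL (initL p) ≟ gcdL p | f (initL p) ≤? maxL p
... | yes _ | yes _ | yes _ = fwFuel k (initL p)
... | _     | _     | _     = f p

fw : List ℕ → ℕ
fw p = fwFuel (length p) p

module Submission where

-- The heart of the argument is a comparison principle for f.  Say that T
-- covers S when S is nonempty, every element of S is a sum of elements of T,
-- and every common divisor of S divides every element of T.  Then
--
--     f(T) ≤ max(T) ⊔ f(S)                                  (covering bound)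
--
-- proved by lexicographic induction on (max S, max T).  With m = min T and
-- n = min S (so m ≤ n), f(T) = m + f(R T) and R T still covers S; if m = n
-- then R T covers R S, and if m < n then R T covers the auxiliary set
-- X = {n-m, n} ∪ (S∖{n} - m), whose image R X covers R S.
--
-- For the proposition, p covers q = p|ₙ₋₁ (q ⊆ p
-- and gcd q = gcd p); fw(q) = f(q) because otherwise fw(q) would be bounded by
-- an entry of q ≤ max p; and fw(p) is either fw(q) or f(p) ≤ max(p) ⊔ f(q).

open import Defs
open import Data.Nat using (ℕ; zero; suc; _+_; _∸_; _⊔_; _<_; _≤_; _≤?_; _<?_; _≟_; z≤n; s≤s)
open import Data.Nat.Base using (>-nonZero)
open import Data.Nat.Properties
open import Data.Nat.Divisibility using (_∣_; _∣0; ∣-refl; ∣-trans; ∣⇒≤; ∣m+n∣m⇒∣n; ∣m∸n∣n⇒∣m)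
open import Data.Nat.GCD using (gcd[m,n]∣m; gcd[m,n]∣n; gcd-greatest)
open import Data.List using (List; []; _∷_; map; length)
open import Data.List.Properties using (length-take)
open import Data.List.Membership.Propositional using (_∈_)
open import Data.List.Membership.Propositional.Properties using (∈-map⁺; ∈-map⁻)
open import Data.List.Relation.Unary.Any using (here; there)
open import Data.List.Relation.Unary.Any.Properties using (¬Any[])
open import Data.List.Relation.Unary.All as All using (All; []; _∷_)
import Data.List.Relation.Unary.All.Properties as Allₚ
open import Data.List.Relation.Unary.AllPairs as AllPairs using (AllPairs; []; _∷_)
import Data.List.Relation.Unary.AllPairs.Properties as AllPairsₚ
open import Data.List.Relation.Unary.Linked.Properties using (Linked⇒AllPairs)
open import Data.List.Relation.Binary.Sublist.Propositional.Properties using (take-⊆; Any-resp-⊆)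
open import Data.Product using (∃; _×_; _,_; proj₁)
open import Data.Sum using (_⊎_; inj₁; inj₂)
open import Data.Empty using (⊥; ⊥-elim)
open import Function using (_∘′_)
open import Relation.Nullary using (¬_; yes; no)
open import Relation.Binary.PropositionalEquality
  using (_≡_; refl; sym; trans; cong; cong₂; subst; module ≡-Reasoning)

IncPos : List ℕ → Set
IncPos X = AllPairs _<_ X × All (0 <_) X

minL : List ℕ → ℕ
minL []      = 0
minL (x ∷ _) = x

-- An increasing list is nontrivial when it has at least two elements.
Nontrivial : List ℕ → Set
Nontrivial X = minL X < maxL X

pos : ∀ {X z} → IncPos X → z ∈ X → 0 < z
pos (_ , X>0) = All.lookup X>0

min∈ : ∀ {X z} → z ∈ X → minL X ∈ X
min∈ {_ ∷ _} _ = here refl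

min≤ : ∀ {X z} → IncPos X → z ∈ X → minL X ≤ z
min≤ _                (here refl) = ≤-refl
min≤ ((x< ∷ _) , _)   (there z∈)  = <⇒≤ (All.lookup x< z∈)

max∈ : ∀ {X z} → z ∈ X → maxL X ∈ X
max∈ {_ ∷ []}    _ = here refl
max∈ {_ ∷ y ∷ _} _ = there (max∈ {y ∷ _} (here refl))

≤max : ∀ {X z} → IncPos X → z ∈ X → z ≤ maxL X
≤max {_ ∷ []}    _                             (here refl) = ≤-refl
≤max {_ ∷ _ ∷ _} ((x< ∷ inc) , (_ ∷ X>0))      (here refl) =
  <⇒≤ (<-≤-trans (All.lookup x< (here refl)) (≤max (inc , X>0) (here refl)))
≤max {_ ∷ _ ∷ _} ((_ ∷ inc) , (_ ∷ X>0))       (there z∈)  = ≤max (inc , X>0) z∈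

tail-inc : ∀ {x X} → IncPos (x ∷ X) → IncPos X
tail-inc (inc , X>0) = AllPairs.tail inc , All.tail X>0

nontrivial-∈ : ∀ {X} → Nontrivial X → minL X ∈ X
nontrivial-∈ {_ ∷ _} _ = here refl

nontrivial₂ : ∀ {x y ys} → IncPos (x ∷ y ∷ ys) → Nontrivial (x ∷ y ∷ ys)
nontrivial₂ sp@((x< ∷ _) , _) = <-≤-trans (All.lookup x< (here refl)) (≤max sp (there (here refl)))

trivial-const : ∀ {X z} → IncPos X → ¬ Nontrivial X → z ∈ X → z ≡ minL X
trivial-const sp triv z∈ = ≤-antisym (≤-trans (≤max sp z∈) (≮⇒≥ triv)) (min≤ sp z∈)

∈-insertNew⁻ : ∀ {x X z} → z ∈ insertNew x X → z ≡ x ⊎ z ∈ X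
∈-insertNew⁻ {x} {[]} (here e) = inj₁ e
∈-insertNew⁻ {x} {y ∷ ys} z∈ with suc x ≤? y | x ≟ y
∈-insertNew⁻ {x} {y ∷ ys} (here e)  | yes _ | _    = inj₁ e
∈-insertNew⁻ {x} {y ∷ ys} (there p) | yes _ | _    = inj₂ p
∈-insertNew⁻ {x} {y ∷ ys} z∈        | no _  | yes _ = inj₂ z∈
∈-insertNew⁻ {x} {y ∷ ys} (here e)  | no _  | no _ = inj₂ (here e)
∈-insertNew⁻ {x} {y ∷ ys} (there p) | no _  | no _ with ∈-insertNew⁻ p
... | inj₁ e  = inj₁ e
... | inj₂ z∈ = inj₂ (there z∈)

insertNew-new : ∀ {x} X → x ∈ insertNew x X
insertNew-new {x} []       = here refl
insertNew-new {x} (y ∷ ys) with suc x ≤? y | x ≟ y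
... | yes _ | _     = here refl
... | no _  | yes e = here e
... | no _  | no _  = there (insertNew-new ys)

insertNew-old : ∀ {x X z} → z ∈ X → z ∈ insertNew x X
insertNew-old {x} {y ∷ ys} z∈ with suc x ≤? y | x ≟ y
insertNew-old {x} {y ∷ ys} z∈        | yes _ | _     = there z∈
insertNew-old {x} {y ∷ ys} z∈        | no _  | yes _ = z∈
insertNew-old {x} {y ∷ ys} (here e)  | no _  | no _  = here e
insertNew-old {x} {y ∷ ys} (there p) | no _  | no _  = there (insertNew-old p)

insertNew-All : ∀ {P : ℕ → Set} {x} X → P x → All P X → All P (insertNew x X)
insertNew-All         []       px []         = px ∷ []
insertNew-All {x = x} (y ∷ ys) px (py ∷ pys) with suc x ≤? y | x ≟ y
... | yes _ | _     = px ∷ py ∷ pys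
... | no _  | yes _ = py ∷ pys
... | no _  | no _  = py ∷ insertNew-All ys px pys

insertNew-sorted : ∀ {x} X → AllPairs _<_ X → AllPairs _<_ (insertNew x X)
insertNew-sorted         []       []           = [] ∷ []
insertNew-sorted {x = x} (y ∷ ys) (y< ∷ inc) with suc x ≤? y | x ≟ y
... | yes x<y | _     = (x<y ∷ All.map (<-trans x<y) y<) ∷ y< ∷ inc
... | no _    | yes _ = y< ∷ inc
... | no x≮y  | no x≢y =
  insertNew-All ys (≤∧≢⇒< (≮⇒≥ x≮y) (λ y≡x → x≢y (sym y≡x))) y< ∷ insertNew-sorted ys inc

insertNew-inc : ∀ {x X} → 0 < x → IncPos X → IncPos (insertNew x X)
insertNew-inc {X = X} x>0 (inc , X>0) = insertNew-sorted X inc , insertNew-All X x>0 X>0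

shift-sorted : ∀ {m X} → All (m <_) X → AllPairs _<_ X → AllPairs _<_ (map (_∸ m) X)
shift-sorted []          []         = []
shift-sorted (m<x ∷ m<X) (x< ∷ inc) =
  Allₚ.map⁺ (All.map (λ x<y → ∸-monoˡ-< x<y (<⇒≤ m<x)) x<) ∷ shift-sorted m<X inc

shift-inc : ∀ {m X} → All (m <_) X → AllPairs _<_ X → IncPos (map (_∸ m) X)
shift-inc m<X inc = shift-sorted m<X inc , Allₚ.map⁺ (All.map m<n⇒0<n∸m m<X)

R-inc : ∀ {X} → IncPos X → IncPos (R X)
R-inc {[]}         sp                          = sp
R-inc {_ ∷ []}     sp                          = sp
R-inc {_ ∷ _ ∷ _}  ((x< ∷ inc) , (x>0 ∷ _))    = insertNew-inc x>0 (shift-inc x< inc)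

∈-R⁻ : ∀ {X z} → IncPos X → z ∈ R X →
       z ≡ minL X ⊎ ∃ λ x → x ∈ X × minL X < x × z ≡ x ∸ minL X
∈-R⁻ {_ ∷ []}    _               (here e) = inj₁ e
∈-R⁻ {x ∷ y ∷ ys} ((x< ∷ _) , _) z∈ with ∈-insertNew⁻ z∈
... | inj₁ e   = inj₁ e
... | inj₂ z∈′ with ∈-map⁻ (_∸ x) z∈′
...   | w , w∈ , e = inj₂ (w , there w∈ , All.lookup x< w∈ , e)

min∈R : ∀ {X z} → z ∈ X → minL X ∈ R X
min∈R {_ ∷ []}    _ = here refl
min∈R {_ ∷ _ ∷ _} _ = insertNew-new _

∸min∈R : ∀ {X x} → x ∈ X → minL X < x → x ∸ minL X ∈ R X
∸min∈R {_ ∷ _}      (here refl) lt = ⊥-elim (<-irrefl refl lt)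
∸min∈R {m ∷ y ∷ ys} (there x∈)  _  = insertNew-old (∈-map⁺ (_∸ m) x∈)

R-∈⇒min∈ : ∀ {X z} → z ∈ R X → minL X ∈ X
R-∈⇒min∈ {_ ∷ _} _ = here refl

R-max< : ∀ {X} → IncPos X → Nontrivial X → maxL (R X) < maxL X
R-max< {X} sp nt = below-max (max∈ (min∈R {X} (nontrivial-∈ nt)))
  where
  below-max : ∀ {z} → z ∈ R X → z < maxL X
  below-max z∈ with ∈-R⁻ sp z∈
  ... | inj₁ refl                = nt
  ... | inj₂ (x , x∈ , lt , refl) =
    <-≤-trans (∸-monoʳ-< (pos sp (min∈ x∈)) (<⇒≤ lt)) (≤max sp x∈)

-- min T + max (R T) ≤ max T ⊔ 2 min T: the largest element of R T is either
-- min T itself or x - min T for some x ∈ T.  This bounds the first step of f.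
min+maxR≤ : ∀ {T} → IncPos T → Nontrivial T → minL T + maxL (R T) ≤ maxL T ⊔ (minL T + minL T)
min+maxR≤ {T} sp nt with ∈-R⁻ sp (max∈ (min∈R {T} (nontrivial-∈ nt)))
... | inj₁ e                  = ≤-trans (≤-reflexive (cong (minL T +_) e)) (m≤n⊔m _ _)
... | inj₂ (x , x∈ , lt , e) = begin
  minL T + maxL (R T)    ≡⟨ cong (minL T +_) e ⟩
  minL T + (x ∸ minL T)  ≡⟨ m+[n∸m]≡n (<⇒≤ lt) ⟩
  x                      ≤⟨ ≤max sp x∈ ⟩
  maxL T                 ≤⟨ m≤m⊔n _ _ ⟩
  maxL T ⊔ (minL T + minL T) ∎
  where open ≤-Reasoning

fFuel-stable : ∀ {k k′ X} → IncPos X → maxL X ≤ k → maxL X ≤ k′ → fFuel k X ≡ fFuel k′ X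
fFuel-stable {X = []}             _  _  _   = refl
fFuel-stable {X = _ ∷ []}         _  _  _   = refl
fFuel-stable {zero}  {X = _ ∷ _ ∷ _} sp le _  = ⊥-elim (<⇒≱ (pos sp (max∈ (here refl))) le)
fFuel-stable {suc _} {zero} {_ ∷ _ ∷ _} sp _ le′ = ⊥-elim (<⇒≱ (pos sp (max∈ (here refl))) le′)
fFuel-stable {suc k} {suc k′} {X@(x ∷ _ ∷ _)} sp le le′ =
  cong (x +_) (fFuel-stable (R-inc sp) (shrink le) (shrink le′))
  where
  shrink : ∀ {j} → maxL X ≤ suc j → maxL (R X) ≤ j
  shrink le″ = ≤-pred (<-≤-trans (R-max< sp (nontrivial₂ sp)) le″)

f-unfold : ∀ {X} → IncPos X → Nontrivial X → f X ≡ minL X + f (R X)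
f-unfold {_ ∷ []}         _  nt = ⊥-elim (<-irrefl refl nt)
f-unfold {X@(x ∷ _ ∷ _)} sp nt =
  trans (fFuel-stable sp ≤-refl (n≤1+n _))
        (cong (x +_) (fFuel-stable (R-inc sp) (<⇒≤ (R-max< sp nt)) ≤-refl))

f-trivial : ∀ {X} → IncPos X → ¬ Nontrivial X → f X ≡ maxL X
f-trivial {[]}        _  _    = refl
f-trivial {_ ∷ []}    _  _    = refl
f-trivial {_ ∷ _ ∷ _} sp triv = ⊥-elim (triv (nontrivial₂ sp))

-- f(X) ≥ max X, by induction along R: max X - min X ∈ R X.
f≥max : ∀ {X} → IncPos X → maxL X ≤ f X
f≥max sp = bounded _ sp ≤-refl
  where
  bounded : ∀ k {X} → IncPos X → maxL X ≤ k → maxL X ≤ f X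
  bounded k {X} spX le with minL X <? maxL X
  ... | no triv = ≤-reflexive (sym (f-trivial spX triv))
  bounded zero    spX le | yes nt = ⊥-elim (<⇒≱ (≤-<-trans z≤n nt) le)
  bounded (suc k) {X} spX le | yes nt = begin
    maxL X                       ≡⟨ m+[n∸m]≡n (<⇒≤ nt) ⟨
    minL X + (maxL X ∸ minL X)   ≤⟨ +-monoʳ-≤ (minL X) (≤-trans diff≤maxR maxR≤fR) ⟩
    minL X + f (R X)             ≡⟨ f-unfold spX nt ⟨
    f X                          ∎
    where
    open ≤-Reasoning
    diff≤maxR : maxL X ∸ minL X ≤ maxL (R X)
    diff≤maxR = ≤max (R-inc spX) (∸min∈R {X} (max∈ (nontrivial-∈ nt)) nt)
    maxR≤fR : maxL (R X) ≤ f (R X)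
    maxR≤fR = bounded k (R-inc spX) (≤-pred (<-≤-trans (R-max< spX nt) le))

-- f(X) ≥ 2 min X for |X| > 1, since min X ∈ R X.
f≥2min : ∀ {X} → IncPos X → Nontrivial X → minL X + minL X ≤ f X
f≥2min {X} sp nt = begin
  minL X + minL X    ≤⟨ +-monoʳ-≤ (minL X) min≤fR ⟩
  minL X + f (R X)   ≡⟨ f-unfold sp nt ⟨
  f X                ∎
  where
  open ≤-Reasoning
  min≤fR : minL X ≤ f (R X)
  min≤fR = ≤-trans (≤max (R-inc sp) (min∈R {X} (nontrivial-∈ nt))) (f≥max (R-inc sp))

data Gen (T : List ℕ) : ℕ → Set where
  base : ∀ {x}   → x ∈ T → Gen T x
  add  : ∀ {x y} → Gen T x → Gen T y → Gen T (x + y)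

Gen-min≤ : ∀ {T x} → IncPos T → Gen T x → minL T ≤ x
Gen-min≤ sp (base x∈) = min≤ sp x∈
Gen-min≤ sp (add g _) = ≤-trans (Gen-min≤ sp g) (m≤m+n _ _)

Gen⇒min∈ : ∀ {T x} → Gen T x → minL T ∈ T
Gen⇒min∈ (base x∈) = min∈ x∈
Gen⇒min∈ (add g _) = Gen⇒min∈ g

-- ⟨T⟩ ⊆ ⟨R T⟩, since x = (x - min T) + min T.
Gen-R : ∀ {T x} → IncPos T → Gen T x → Gen (R T) x
Gen-R {T} sp (base x∈) with m≤n⇒m<n∨m≡n (min≤ sp x∈)
... | inj₂ e  = subst (Gen (R T)) e (base (min∈R x∈))
... | inj₁ lt = subst (Gen (R T)) (m∸n+n≡m (<⇒≤ lt)) (add (base (∸min∈R x∈ lt)) (base (min∈R x∈)))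
Gen-R sp (add g h) = add (Gen-R sp g) (Gen-R sp h)

Gen-R-∸ : ∀ {T x} → IncPos T → Gen T x → minL T < x → Gen (R T) (x ∸ minL T)
Gen-R-∸ sp (base x∈) lt = base (∸min∈R x∈ lt)
Gen-R-∸ {T} sp (add {x} {y} g h) lt with m≤n⇒m<n∨m≡n (Gen-min≤ sp g)
... | inj₂ refl = subst (Gen (R T)) (sym (m+n∸m≡n (minL T) y)) (Gen-R sp h)
... | inj₁ lt′  = subst (Gen (R T)) (sym (+-∸-comm y (<⇒≤ lt′))) (add (Gen-R-∸ sp g lt′) (Gen-R sp h))

DividesAll : ℕ → List ℕ → Set
DividesAll d X = ∀ {x} → x ∈ X → d ∣ x

∣-∸ : ∀ {d a b} → d ∣ a → d ∣ b → b ≤ a → d ∣ a ∸ b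
∣-∸ {d} d∣a d∣b b≤a = ∣m+n∣m⇒∣n (subst (d ∣_) (sym (m+[n∸m]≡n b≤a)) d∣a) d∣b

∣<⇒double≤ : ∀ {m x} → m ∣ x → m < x → m + m ≤ x
∣<⇒double≤ {m} m∣x m<x = begin
  m + m        ≤⟨ +-monoʳ-≤ m (∣⇒≤ {{>-nonZero (m<n⇒0<n∸m m<x)}} (∣-∸ m∣x ∣-refl (<⇒≤ m<x))) ⟩
  m + (_ ∸ m)  ≡⟨ m+[n∸m]≡n (<⇒≤ m<x) ⟩
  _            ∎
  where open ≤-Reasoning

R-divides : ∀ {X d} → IncPos X → DividesAll d X → DividesAll d (R X)
R-divides sp d∣X z∈ with ∈-R⁻ sp z∈
... | inj₁ refl                 = d∣X (R-∈⇒min∈ z∈)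
... | inj₂ (x , x∈ , lt , refl) = ∣-∸ (d∣X x∈) (d∣X (min∈ x∈)) (<⇒≤ lt)

R-divides⁻ : ∀ {X d} → IncPos X → DividesAll d (R X) → DividesAll d X
R-divides⁻ {d = d} sp d∣RX x∈ with m≤n⇒m<n∨m≡n (min≤ sp x∈)
... | inj₂ e  = subst (d ∣_) e (d∣RX (min∈R x∈))
... | inj₁ lt = ∣m∸n∣n⇒∣m d (<⇒≤ lt) (d∣RX (∸min∈R x∈ lt)) (d∣RX (min∈R x∈))

trivial-divides : ∀ {S} → IncPos S → ¬ Nontrivial S → DividesAll (minL S) S
trivial-divides sp triv s∈ = subst (_ ∣_) (sym (trivial-const sp triv s∈)) ∣-refl

record Covers (T S : List ℕ) : Set where
  field
    nonempty  : minL S ∈ S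
    generated : ∀ {s} → s ∈ S → Gen T s
    divisors  : ∀ {d} → DividesAll d S → DividesAll d T

  min∈T : minL T ∈ T
  min∈T = Gen⇒min∈ (generated nonempty)

  minT≤minS : IncPos T → minL T ≤ minL S
  minT≤minS spT = Gen-min≤ spT (generated nonempty)

covers-R-left : ∀ {T S} → IncPos T → Covers T S → Covers (R T) S
covers-R-left spT cov = record
  { nonempty  = nonempty
  ; generated = λ s∈ → Gen-R spT (generated s∈)
  ; divisors  = λ d∣S → R-divides spT (divisors d∣S)
  }
  where open Covers cov

covers-R-both : ∀ {T S} → IncPos T → IncPos S → Covers T S → minL T ≡ minL S → Covers (R T) (R S)
covers-R-both {T} {S} spT spS cov eq = record
  { nonempty  = min∈ (min∈R nonempty)
  ; generated = generatedR
  ; divisors  = λ d∣RS → R-divides spT (divisors (R-divides⁻ spS d∣RS))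
  }
  where
  open Covers cov
  generatedR : ∀ {s} → s ∈ R S → Gen (R T) s
  generatedR s∈ with ∈-R⁻ spS s∈
  ... | inj₁ refl = subst (Gen (R T)) eq (base (min∈R min∈T))
  ... | inj₂ (x , x∈ , lt , refl) =
    subst (λ k → Gen (R T) (x ∸ k)) eq (Gen-R-∸ spT (generated x∈) (subst (_< x) (sym eq) lt))

-- The auxiliary set X = {n-m, n} ∪ (S' - m) for S = n ∷ S' and m = min T < n.
-- R T covers X, R X covers R S, and m + f(X) ≤ f(S) whenever the covering
-- bound holds for (R X, R S).
module Shift {T : List ℕ} {n : ℕ} {S′ : List ℕ}
             (spT : IncPos T) (spS : IncPos (n ∷ S′)) (cov : Covers T (n ∷ S′))
             (m<n : minL T < n) where

  open Covers cov

  S : List ℕ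
  S = n ∷ S′

  m : ℕ
  m = minL T

  X : List ℕ
  X = insertNew (n ∸ m) (insertNew n (map (_∸ m) S′))

  n<S′ : All (n <_) S′
  n<S′ = AllPairs.head (proj₁ spS)

  m<S′ : ∀ {x} → x ∈ S′ → m < x
  m<S′ x∈ = <-trans m<n (All.lookup n<S′ x∈)

  X-inc : IncPos X
  X-inc = insertNew-inc (m<n⇒0<n∸m m<n)
            (insertNew-inc (pos spS (here refl))
              (shift-inc (All.map (<-trans m<n) n<S′) (proj₁ (tail-inc spS))))

  ∈X⁻ : ∀ {z} → z ∈ X → z ≡ n ∸ m ⊎ z ≡ n ⊎ ∃ λ x → x ∈ S′ × z ≡ x ∸ m
  ∈X⁻ z∈ with ∈-insertNew⁻ z∈
  ... | inj₁ e   = inj₁ e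
  ... | inj₂ z∈₁ with ∈-insertNew⁻ z∈₁
  ...   | inj₁ e   = inj₂ (inj₁ e)
  ...   | inj₂ z∈₂ = inj₂ (inj₂ (∈-map⁻ (_∸ m) z∈₂))

  n∸m∈X : n ∸ m ∈ X
  n∸m∈X = insertNew-new (insertNew n (map (_∸ m) S′))

  n∈X : n ∈ X
  n∈X = insertNew-old {n ∸ m} (insertNew-new (map (_∸ m) S′))

  shifted∈X : ∀ {x} → x ∈ S′ → x ∸ m ∈ X
  shifted∈X x∈ = insertNew-old (insertNew-old (∈-map⁺ (_∸ m) x∈))

  minX : minL X ≡ n ∸ m
  minX = ≤-antisym (min≤ X-inc n∸m∈X) (n∸m≤ (min∈ n∸m∈X))
    where
    n∸m≤ : ∀ {z} → z ∈ X → n ∸ m ≤ z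
    n∸m≤ z∈ with ∈X⁻ z∈
    ... | inj₁ refl                 = ≤-refl
    ... | inj₂ (inj₁ refl)          = m∸n≤m n m
    ... | inj₂ (inj₂ (x , x∈ , refl)) = ∸-monoˡ-≤ m (<⇒≤ (All.lookup n<S′ x∈))

  maxX≤maxS : maxL X ≤ maxL S
  maxX≤maxS = ≤maxS (max∈ n∈X)
    where
    ≤maxS : ∀ {z} → z ∈ X → z ≤ maxL S
    ≤maxS z∈ with ∈X⁻ z∈
    ... | inj₁ refl                 = ≤-trans (m∸n≤m n m) (≤max spS (here refl))
    ... | inj₂ (inj₁ refl)          = ≤max spS (here refl)
    ... | inj₂ (inj₂ (x , x∈ , refl)) = ≤-trans (m∸n≤m x m) (≤max spS (there x∈))

  n∸m<n : n ∸ m < n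
  n∸m<n = ∸-monoʳ-< (pos spT min∈T) (<⇒≤ m<n)

  X-nontrivial : Nontrivial X
  X-nontrivial = subst (_< maxL X) (sym minX) (<-≤-trans n∸m<n (≤max X-inc n∈X))

  shift-shift : ∀ x → (x ∸ m) ∸ minL X ≡ x ∸ n
  shift-shift x = begin
    (x ∸ m) ∸ minL X     ≡⟨ cong ((x ∸ m) ∸_) minX ⟩
    (x ∸ m) ∸ (n ∸ m)    ≡⟨ ∸-+-assoc x m (n ∸ m) ⟩
    x ∸ (m + (n ∸ m))    ≡⟨ cong (x ∸_) (m+[n∸m]≡n (<⇒≤ m<n)) ⟩
    x ∸ n                ∎
    where open ≡-Reasoning

  X-div⇒S-div : ∀ {d} → DividesAll d X → DividesAll d S
  X-div⇒S-div {d} d∣X (here refl) = d∣X n∈X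
  X-div⇒S-div {d} d∣X (there x∈)  = ∣m∸n∣n⇒∣m d (<⇒≤ (m<S′ x∈)) (d∣X (shifted∈X x∈)) d∣m
    where
    d∣m : d ∣ m
    d∣m = ∣m+n∣m⇒∣n (subst (d ∣_) (sym (m∸n+n≡m (<⇒≤ m<n))) (d∣X n∈X)) (d∣X n∸m∈X)

  S-div⇒X-div : ∀ {d} → DividesAll d S → DividesAll d X
  S-div⇒X-div d∣S z∈ with ∈X⁻ z∈
  ... | inj₁ refl                 = ∣-∸ (d∣S (here refl)) (divisors d∣S min∈T) (<⇒≤ m<n)
  ... | inj₂ (inj₁ refl)          = d∣S (here refl)
  ... | inj₂ (inj₂ (x , x∈ , refl)) = ∣-∸ (d∣S (there x∈)) (divisors d∣S min∈T) (<⇒≤ (m<S′ x∈))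

  covers-shift : Covers (R T) X
  covers-shift = record
    { nonempty  = min∈ n∸m∈X
    ; generated = generatedX
    ; divisors  = λ d∣X → R-divides spT (divisors (X-div⇒S-div d∣X))
    }
    where
    generatedX : ∀ {z} → z ∈ X → Gen (R T) z
    generatedX z∈ with ∈X⁻ z∈
    ... | inj₁ refl                 = Gen-R-∸ spT (generated (here refl)) m<n
    ... | inj₂ (inj₁ refl)          = Gen-R spT (generated (here refl))
    ... | inj₂ (inj₂ (x , x∈ , refl)) = Gen-R-∸ spT (generated (there x∈)) (m<S′ x∈)

  covers-RX-RS : Covers (R X) (R S)
  covers-RX-RS = record
    { nonempty  = min∈ (min∈R {S} (here refl))
    ; generated = generatedRS
    ; divisors  = λ d∣RS → R-divides X-inc (S-div⇒X-div (R-divides⁻ spS d∣RS))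
    }
    where
    minX<n : minL X < n
    minX<n = subst (_< n) (sym minX) n∸m<n
    -- n = (n - m) + m with n - m = min X and m = n - min X both in R X.
    n∈⟨RX⟩ : Gen (R X) n
    n∈⟨RX⟩ = subst (Gen (R X)) n∸m+m≡n (add (base n∸m∈RX) (base m∈RX))
      where
      n∸m∈RX : n ∸ m ∈ R X
      n∸m∈RX = subst (_∈ R X) minX (min∈R n∈X)
      m∈RX : m ∈ R X
      m∈RX = subst (_∈ R X) (trans (cong (n ∸_) minX) (m∸[m∸n]≡n (<⇒≤ m<n))) (∸min∈R n∈X minX<n)
      n∸m+m≡n : n ∸ m + m ≡ n
      n∸m+m≡n = m∸n+n≡m (<⇒≤ m<n)
    generatedRS : ∀ {z} → z ∈ R S → Gen (R X) z
    generatedRS z∈ with ∈-R⁻ spS z∈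
    ... | inj₁ refl = n∈⟨RX⟩
    ... | inj₂ (_ , here refl , n<n , _) = ⊥-elim (<-irrefl refl n<n)
    ... | inj₂ (x , there x∈ , n<x , refl) =
      subst (Gen (R X)) (shift-shift x)
        (base (∸min∈R (shifted∈X x∈) (subst (_< x ∸ m) (sym minX) (∸-monoˡ-< n<x (<⇒≤ m<n)))))

  -- Every element of R X is at most n or lies in R S.
  maxRX≤maxRS : maxL (R X) ≤ maxL (R S)
  maxRX≤maxRS = ≤maxRS (max∈ (min∈R n∈X))
    where
    n≤maxRS : n ≤ maxL (R S)
    n≤maxRS = ≤max (R-inc spS) (min∈R {S} (here refl))
    ≤maxRS : ∀ {z} → z ∈ R X → z ≤ maxL (R S)
    ≤maxRS z∈ with ∈-R⁻ X-inc z∈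
    ... | inj₁ refl = subst (_≤ maxL (R S)) (sym minX) (≤-trans (m∸n≤m n m) n≤maxRS)
    ... | inj₂ (x′ , x′∈ , _ , refl) with ∈X⁻ x′∈
    ...   | inj₁ refl        = ≤-trans (m∸n≤m _ (minL X)) (≤-trans (m∸n≤m n m) n≤maxRS)
    ...   | inj₂ (inj₁ refl) = ≤-trans (m∸n≤m n (minL X)) n≤maxRS
    ...   | inj₂ (inj₂ (x , x∈ , refl)) =
      subst (_≤ maxL (R S)) (sym (shift-shift x))
        (≤max (R-inc spS) (∸min∈R (there x∈) (All.lookup n<S′ x∈)))

  m+fX≤fS : Nontrivial S → f (R X) ≤ maxL (R X) ⊔ f (R S) → m + f X ≤ f S
  m+fX≤fS ntS bound = begin
    m + f X                  ≡⟨ cong (m +_) (f-unfold X-inc X-nontrivial) ⟩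
    m + (minL X + f (R X))   ≡⟨ cong (λ k → m + (k + f (R X))) minX ⟩
    m + ((n ∸ m) + f (R X))  ≤⟨ +-monoʳ-≤ m (+-monoʳ-≤ (n ∸ m) fRX≤fRS) ⟩
    m + ((n ∸ m) + f (R S))  ≡⟨ +-assoc m (n ∸ m) _ ⟨
    (m + (n ∸ m)) + f (R S)  ≡⟨ cong (_+ f (R S)) (m+[n∸m]≡n (<⇒≤ m<n)) ⟩
    n + f (R S)              ≡⟨ f-unfold spS ntS ⟨
    f S                      ∎
    where
    open ≤-Reasoning
    fRX≤fRS : f (R X) ≤ f (R S)
    fRX≤fRS = ≤-trans bound (⊔-lub (≤-trans maxRX≤maxRS (f≥max (R-inc spS))) ≤-refl)

CoverBound : ℕ → ℕ → Set
CoverBound a b = ∀ {T S} → IncPos T → IncPos S → maxL S ≤ a → maxL T ≤ b →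
                 Covers T S → f T ≤ maxL T ⊔ f S

descend : ∀ {T Y F} → IncPos T → Nontrivial T → f (R T) ≤ maxL (R T) ⊔ Y →
          minL T + minL T ≤ maxL T ⊔ F → minL T + Y ≤ maxL T ⊔ F → f T ≤ maxL T ⊔ F
descend {T} {Y} {F} spT nt bound double≤ shifted≤ = begin
  f T                                  ≡⟨ f-unfold spT nt ⟩
  m + f (R T)                          ≤⟨ +-monoʳ-≤ m bound ⟩
  m + (maxL (R T) ⊔ Y)                 ≡⟨ +-distribˡ-⊔ m (maxL (R T)) Y ⟩
  (m + maxL (R T)) ⊔ (m + Y)           ≤⟨ ⊔-lub (≤-trans (min+maxR≤ spT nt) (⊔-lub (m≤m⊔n _ _) double≤)) shifted≤ ⟩
  maxL T ⊔ F                           ∎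
  where
  open ≤-Reasoning
  m : ℕ
  m = minL T

module CoverStep {a b : ℕ} (IHa : ∀ {b′} → CoverBound a b′) (IHb : CoverBound (suc a) b)
                 {T : List ℕ} {n : ℕ} {S′ : List ℕ}
                 (spT : IncPos T) (spS : IncPos (n ∷ S′))
                 (la : maxL (n ∷ S′) ≤ suc a) (lb : maxL T ≤ suc b)
                 (cov : Covers T (n ∷ S′)) where

  open Covers cov

  S : List ℕ
  S = n ∷ S′

  m : ℕ
  m = minL T

  maxRT≤b : Nontrivial T → maxL (R T) ≤ b
  maxRT≤b ntT = ≤-pred (<-≤-trans (R-max< spT ntT) lb)

  maxRS≤a : Nontrivial S → maxL (R S) ≤ a
  maxRS≤a ntS = ≤-pred (<-≤-trans (R-max< spS ntS) la)

  -- S = {m}: every element of T is a multiple of m, so 2m ≤ max T.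
  equal-trivial : Nontrivial T → m ≡ n → ¬ Nontrivial S → f T ≤ maxL T ⊔ f S
  equal-trivial ntT m≡n trivS =
    descend spT ntT (IHb (R-inc spT) spS la (maxRT≤b ntT) (covers-R-left spT cov))
      (subst (λ k → k + k ≤ maxL T ⊔ f S) (sym m≡n) 2n≤)
      (subst (_≤ maxL T ⊔ f S) (cong₂ _+_ (sym m≡n) (sym fS≡n)) 2n≤)
    where
    fS≡n : f S ≡ n
    fS≡n = trans (f-trivial spS trivS) (trivial-const spS trivS (max∈ (here refl)))
    2n≤ : n + n ≤ maxL T ⊔ f S
    2n≤ = ≤-trans (∣<⇒double≤ (divisors (trivial-divides spS trivS) (max∈ min∈T))
                               (subst (_< maxL T) m≡n ntT))
                  (m≤m⊔n _ _)

  -- m = n and |S| > 1: R T covers R S, and f(S) = m + f(R S) ≥ 2m.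
  equal-nontrivial : Nontrivial T → m ≡ n → Nontrivial S → f T ≤ maxL T ⊔ f S
  equal-nontrivial ntT m≡n ntS =
    descend spT ntT (IHa (R-inc spT) (R-inc spS) (maxRS≤a ntS) ≤-refl (covers-R-both spT spS cov m≡n))
      (≤-trans (subst (λ k → k + k ≤ f S) (sym m≡n) (f≥2min spS ntS)) (m≤n⊔m _ _))
      (≤-trans (≤-reflexive (trans (cong (_+ f (R S)) m≡n) (sym (f-unfold spS ntS)))) (m≤n⊔m _ _))

  -- m < n and S = {n}: n would divide m ∈ T, impossible.
  smaller-trivial : m < n → ¬ Nontrivial S → ⊥
  smaller-trivial m<n trivS =
    <⇒≱ m<n (∣⇒≤ {{>-nonZero (pos spT min∈T)}} (divisors (trivial-divides spS trivS) min∈T))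

  smaller-nontrivial : Nontrivial T → m < n → Nontrivial S → f T ≤ maxL T ⊔ f S
  smaller-nontrivial ntT m<n ntS =
    descend spT ntT (IHb (R-inc spT) X-inc (≤-trans maxX≤maxS la) (maxRT≤b ntT) covers-shift)
      (≤-trans (≤-trans (+-mono-≤ (<⇒≤ m<n) (<⇒≤ m<n)) (f≥2min spS ntS)) (m≤n⊔m _ _))
      (≤-trans (m+fX≤fS ntS boundX) (m≤n⊔m _ _))
    where
    open Shift spT spS cov m<n using (X; X-inc; maxX≤maxS; covers-shift; covers-RX-RS; m+fX≤fS)
    boundX : f (R X) ≤ maxL (R X) ⊔ f (R S)
    boundX = IHa (R-inc X-inc) (R-inc spS) (maxRS≤a ntS) ≤-refl covers-RX-RS

  bound : f T ≤ maxL T ⊔ f S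
  bound with minL T <? maxL T
  ... | no trivT = ≤-trans (≤-reflexive (f-trivial spT trivT)) (m≤m⊔n _ _)
  ... | yes ntT with m≤n⇒m<n∨m≡n (minT≤minS spT) | n <? maxL S
  ...   | inj₂ m≡n | no trivS = equal-trivial ntT m≡n trivS
  ...   | inj₂ m≡n | yes ntS  = equal-nontrivial ntT m≡n ntS
  ...   | inj₁ m<n | no trivS = ⊥-elim (smaller-trivial m<n trivS)
  ...   | inj₁ m<n | yes ntS  = smaller-nontrivial ntT m<n ntS

-- The covering bound for all measures, by lexicographic recursion on (a, b);
-- when a or b is 0 the hypotheses are contradictory (entries are positive).
cover-bound-fuel : ∀ a b → CoverBound a b
cover-bound-fuel a b {S = []} _ _ _ _ cov = ⊥-elim (¬Any[] (Covers.nonempty cov))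
cover-bound-fuel zero b {S = _ ∷ _} _ spS la _ _ =
  ⊥-elim (<⇒≱ (pos spS (max∈ (here refl))) la)
cover-bound-fuel (suc a) zero {S = _ ∷ _} spT _ _ lb cov =
  ⊥-elim (<⇒≱ (pos spT (max∈ (Covers.min∈T cov))) lb)
cover-bound-fuel (suc a) (suc b) {S = _ ∷ _} spT spS la lb cov =
  CoverStep.bound (cover-bound-fuel a _) (cover-bound-fuel (suc a) b) spT spS la lb cov

covering-bound : ∀ {T S} → IncPos T → IncPos S → Covers T S → f T ≤ maxL T ⊔ f S
covering-bound spT spS = cover-bound-fuel _ _ spT spS ≤-refl ≤-refl

∈-initL : ∀ {X z} → z ∈ initL X → z ∈ X
∈-initL {X} = Any-resp-⊆ (take-⊆ _ X)

initL-inc : ∀ {X} → IncPos X → IncPos (initL X)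
initL-inc (inc , X>0) = AllPairsₚ.take⁺ _ inc , Allₚ.take⁺ _ X>0

length-initL : ∀ x X → length (initL (x ∷ X)) ≡ length X
length-initL x X = trans (length-take (length X) (x ∷ X)) (m≤n⇒m⊓n≡m (n≤1+n _))

gcdL-greatest : ∀ {d} X → DividesAll d X → d ∣ gcdL X
gcdL-greatest []      _   = _ ∣0
gcdL-greatest (x ∷ X) d∣X = gcd-greatest (d∣X (here refl)) (gcdL-greatest X (d∣X ∘′ there))

gcdL-∣ : ∀ {X x} → x ∈ X → gcdL X ∣ x
gcdL-∣ {y ∷ X} (here refl) = gcd[m,n]∣m y (gcdL X)
gcdL-∣ {y ∷ X} (there x∈)  = ∣-trans (gcd[m,n]∣n y (gcdL X)) (gcdL-∣ x∈)

initL-covers : ∀ {p} → 1 < length p → gcdL (initL p) ≡ gcdL p → Covers p (initL p)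
initL-covers {_ ∷ []}    (s≤s ()) _
initL-covers {_ ∷ _ ∷ _} _ gcd≡ = record
  { nonempty  = here refl
  ; generated = λ s∈ → base (∈-initL s∈)
  ; divisors  = λ d∣q x∈ → ∣-trans (subst (_ ∣_) gcd≡ (gcdL-greatest _ d∣q)) (gcdL-∣ x∈)
  }

fwFuel-step : ∀ k Y → fwFuel (suc k) Y ≡ fwFuel k (initL Y) ⊎ fwFuel (suc k) Y ≡ f Y
fwFuel-step k Y with 2 ≤? length Y | gcdL (initL Y) ≟ gcdL Y | f (initL Y) ≤? maxL Y
... | yes _ | yes _ | yes _ = inj₁ refl
... | no _  | _     | _     = inj₂ refl
... | yes _ | no _  | _     = inj₂ refl
... | yes _ | yes _ | no _  = inj₂ refl

fw-cases : ∀ X → fw X ≡ fw (initL X) ⊎ fw X ≡ f X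
fw-cases []      = inj₂ refl
fw-cases (x ∷ X) with fwFuel-step (length X) (x ∷ X)
... | inj₁ e = inj₁ (trans e (cong (λ k → fwFuel k (initL (x ∷ X))) (sym (length-initL x X))))
... | inj₂ e = inj₂ e

long-min∈ : ∀ X → 2 ≤ length X → minL X ∈ X
long-min∈ (_ ∷ _) _ = here refl

fw-f-or-below : ∀ X → fw X ≡ f X ⊎ ∃ λ x → x ∈ X × fw X ≤ x
fw-f-or-below X = fuel (length X) X
  where
  fuel : ∀ k Y → fwFuel k Y ≡ f Y ⊎ ∃ λ y → y ∈ Y × fwFuel k Y ≤ y
  fuel zero Y = inj₁ refl
  fuel (suc k) Y with 2 ≤? length Y | gcdL (initL Y) ≟ gcdL Y | f (initL Y) ≤? maxL Y
  ... | yes 2≤ | yes _ | yes le with fuel k (initL Y)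
  ...   | inj₁ e               = inj₂ (maxL Y , max∈ (long-min∈ Y 2≤) , subst (_≤ maxL Y) (sym e) le)
  ...   | inj₂ (y , y∈ , le′)  = inj₂ (y , ∈-initL y∈ , le′)
  fuel (suc k) Y | no _  | _     | _    = inj₁ refl
  fuel (suc k) Y | yes _ | no _  | _    = inj₁ refl
  fuel (suc k) Y | yes _ | yes _ | no _ = inj₁ refl

proposition41 : (p : List ℕ) → IsOFS p → 1 < length p →
                gcdL (initL p) ≡ gcdL p →
                maxL p < fw (initL p) →
                fw p ≤ fw (initL p)
proposition41 p (_ , p>0 , linked) len gcd≡ max<fw with fw-cases p
... | inj₁ fw≡ = ≤-reflexive fw≡
... | inj₂ fw≡f = begin
  fw p            ≡⟨ fw≡f ⟩
  f p             ≤⟨ covering-bound spP (initL-inc spP) (initL-covers len gcd≡) ⟩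
  maxL p ⊔ f q    ≡⟨ m≤n⇒m⊔n≡n (<⇒≤ (subst (maxL p <_) fwq≡fq max<fw)) ⟩
  f q             ≡⟨ fwq≡fq ⟨
  fw q            ∎
  where
  open ≤-Reasoning
  q : List ℕ
  q = initL p
  spP : IncPos p
  spP = Linked⇒AllPairs <-trans linked , p>0
  -- fw q cannot be bounded by an entry of q, since those are ≤ max p < fw q.
  fwq≡fq : fw q ≡ f q
  fwq≡fq with fw-f-or-below q
  ... | inj₁ e              = e
  ... | inj₂ (x , x∈ , le) = ⊥-elim (<⇒≱ max<fw (≤-trans le (≤max spP (∈-initL x∈))))
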